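{- Let $a$ be an integer with $a\notin\{0,1,-1\}$, and let $\{u_n\}_{n\geq0}$ be defined by $u_0=0$, $u_1=1$, $u_{n+1}=(2-a)u_n-(a^2-a+1)u_{n-1}$ for $n\geq1$. Then for all $n\geq1$, $$\Delta_3(0,n)=(2-a)u_n-2(a^2-a+1)u_{n-1}=2u_{n+1}-(2-a)u_n,$$ $$\Delta_3(1,n)=(2a-1)u_n+(a^2-a+1)u_{n-1}=-u_{n+1}+(a+1)u_n,$$ $$\Delta_3(2,n)=(-a-1)u_n+(a^2-a+1)u_{n-1}=-u_{n+1}-(2a-1)u_n.$$
   Context: For integers $n>0$ and $r$, $\Delta_3(r,n)=3\sum_{0\le k\le n,\ k\equiv r\ (\mathrm{mod}\ 3)}\binom nk a^k-(1+a)^n$. -}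

module Defs where

open import Data.Nat as ℕ using (ℕ; zero; suc)
open import Data.Nat.DivMod using (_%_)
open import Data.Nat.Combinatorics using (_C_)
open import Data.Integer using (ℤ; +_; _+_; _-_; _*_; -_; _^_)
open import Relation.Nullary using (yes; no)

u : ℤ → ℕ → ℤ
u a zero = + 0
u a (suc zero) = + 1
u a (suc (suc n)) = (+ 2 - a) * u a (suc n) - (a * a - a + + 1) * u a n

sumRes : ℤ → ℕ → ℕ → ℕ → ℤ
sumRes a r n zero with 0 % 3 ℕ.≟ r % 3
... | yes _ = + (n C 0) * a ^ 0
... | no _ = + 0
sumRes a r n (suc k) with suc k % 3 ℕ.≟ r % 3
... | yes _ = sumRes a r n k + + (n C suc k) * a ^ suc k
... | no _ = sumRes a r n k

Δ₃ : ℤ → ℕ → ℕ → ℤ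
Δ₃ a r n = + 3 * sumRes a r n n - (+ 1 + a) ^ n

{-# OPTIONS --safe #-}
module Submission where

-- Pascal's rule C(n+1,k) = C(n,k) + C(n,k-1) shifts the residue of k by one, so
-- Δ₃(r,n+1) = Δ₃(r,n) + a Δ₃(r-1,n). Since Δ₃(0,n) + Δ₃(1,n) + Δ₃(2,n) = 0, the
-- eigenvalue 1 + a of this cyclic recurrence drops out, leaving 1 + aω and 1 + aω̄,
-- the roots of x² - (2-a) x + (a² - a + 1). Hence the three closed forms in u obey
-- the same recurrence, and they agree with Δ₃ at n = 0.

open import Defs
open import Data.Nat as ℕ using (ℕ; suc; zero)
open import Data.Nat.DivMod using (_%_; [m+n]%n≡m%n)
open import Data.Nat.Combinatorics using (_C_; nCk+nC[k+1]≡[n+1]C[k+1]; k>n⇒nCk≡0)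
import Data.Nat.Properties as ℕₚ
open import Data.Integer using (ℤ; +_; _+_; _-_; _*_; -_; _^_)
open import Data.Integer.Properties using (pos-+; +-assoc; +-identityʳ; *-identityˡ; *-zeroˡ; *-zeroʳ)
open import Data.Integer.Tactic.RingSolver using (solve-∀)
open import Data.Product using (_×_; _,_)
open import Relation.Nullary using (yes; no)
open import Relation.Binary.PropositionalEquality
open ≡-Reasoning

δ : ℕ → ℕ → ℤ
δ i j with i ℕ.≟ j
... | yes _ = + 1
... | no _ = + 0

[_≡_]₃ : ℕ → ℕ → ℤ
[ k ≡ r ]₃ = δ (k % 3) (r % 3)

[3+k≡r]₃ : ∀ k r → [ 3 ℕ.+ k ≡ r ]₃ ≡ [ k ≡ r ]₃
[3+k≡r]₃ k r =
  cong (λ i → δ i (r % 3)) (trans (cong (_% 3) (ℕₚ.+-comm 3 k)) ([m+n]%n≡m%n k 3))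

record ResiduePredecessor (r r' : ℕ) : Set where
  constructor residuePredecessor
  field shift : ∀ k → [ suc k ≡ r ]₃ ≡ [ k ≡ r' ]₃

residuePredecessor-from-period : ∀ r r' →
  [ 1 ≡ r ]₃ ≡ [ 0 ≡ r' ]₃ → [ 2 ≡ r ]₃ ≡ [ 1 ≡ r' ]₃ → [ 3 ≡ r ]₃ ≡ [ 2 ≡ r' ]₃ →
  ∀ k → [ suc k ≡ r ]₃ ≡ [ k ≡ r' ]₃
residuePredecessor-from-period r r' e₀ e₁ e₂ zero = e₀
residuePredecessor-from-period r r' e₀ e₁ e₂ (suc zero) = e₁
residuePredecessor-from-period r r' e₀ e₁ e₂ (suc (suc zero)) = e₂
residuePredecessor-from-period r r' e₀ e₁ e₂ (suc (suc (suc k))) = begin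
  [ 3 ℕ.+ suc k ≡ r ]₃  ≡⟨ [3+k≡r]₃ (suc k) r ⟩
  [ suc k ≡ r ]₃        ≡⟨ residuePredecessor-from-period r r' e₀ e₁ e₂ k ⟩
  [ k ≡ r' ]₃           ≡⟨ [3+k≡r]₃ k r' ⟨
  [ 3 ℕ.+ k ≡ r' ]₃     ∎

pred₃-0 : ResiduePredecessor 0 2
pred₃-0 = residuePredecessor (residuePredecessor-from-period 0 2 refl refl refl)

pred₃-1 : ResiduePredecessor 1 0
pred₃-1 = residuePredecessor (residuePredecessor-from-period 1 0 refl refl refl)

pred₃-2 : ResiduePredecessor 2 1
pred₃-2 = residuePredecessor (residuePredecessor-from-period 2 1 refl refl refl)

binomialTerm : ℤ → ℕ → ℕ → ℕ → ℤ
binomialTerm a r n k = [ k ≡ r ]₃ * (+ (n C k) * a ^ k)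

sumRes-zero : ∀ a r n → sumRes a r n 0 ≡ binomialTerm a r n 0
sumRes-zero a r n with 0 % 3 ℕ.≟ r % 3
... | yes _ = refl
... | no _ = refl

sumRes-suc : ∀ a r n k → sumRes a r n (suc k) ≡ sumRes a r n k + binomialTerm a r n (suc k)
sumRes-suc a r n k with suc k % 3 ℕ.≟ r % 3
... | yes _ = cong (λ x → sumRes a r n k + x) (sym (*-identityˡ (+ (n C suc k) * a ^ suc k)))
... | no _ = sym (trans (cong (λ x → sumRes a r n k + x) (*-zeroˡ (+ (n C suc k) * a ^ suc k))) (+-identityʳ _))

sumRes-suc-zero : ∀ a r n → sumRes a r (suc n) 0 ≡ sumRes a r n 0
sumRes-suc-zero a r n = trans (sumRes-zero a r (suc n)) (sym (sumRes-zero a r n))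

binomialTerm-beyond : ∀ a r n → binomialTerm a r n (suc n) ≡ + 0
binomialTerm-beyond a r n = begin
  [ suc n ≡ r ]₃ * (+ (n C suc n) * a ^ suc n)
    ≡⟨ cong (λ c → [ suc n ≡ r ]₃ * (+ c * a ^ suc n)) (k>n⇒nCk≡0 (ℕₚ.n<1+n n)) ⟩
  [ suc n ≡ r ]₃ * (+ 0 * a ^ suc n)
    ≡⟨ cong ([ suc n ≡ r ]₃ *_) (*-zeroˡ (a ^ suc n)) ⟩
  [ suc n ≡ r ]₃ * + 0
    ≡⟨ *-zeroʳ [ suc n ≡ r ]₃ ⟩
  + 0
    ∎

binomialTerm-pascal : ∀ a {r r'} → ResiduePredecessor r r' → ∀ n k →
  binomialTerm a r (suc n) (suc k) ≡ binomialTerm a r n (suc k) + a * binomialTerm a r' n k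
binomialTerm-pascal a {r} {r'} pred n k = begin
  [ suc k ≡ r ]₃ * (+ (suc n C suc k) * a ^ suc k)
    ≡⟨ cong₂ (λ i c → i * (c * (a * a ^ k))) (ResiduePredecessor.shift pred k) pascal ⟩
  [ k ≡ r' ]₃ * ((+ (n C k) + + (n C suc k)) * (a * a ^ k))
    ≡⟨ distribute a [ k ≡ r' ]₃ (+ (n C k)) (+ (n C suc k)) (a ^ k) ⟩
  [ k ≡ r' ]₃ * (+ (n C suc k) * a ^ suc k) + a * binomialTerm a r' n k
    ≡⟨ cong (λ i → i * (+ (n C suc k) * a ^ suc k) + a * binomialTerm a r' n k) (ResiduePredecessor.shift pred k) ⟨
  [ suc k ≡ r ]₃ * (+ (n C suc k) * a ^ suc k) + a * binomialTerm a r' n k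
    ∎
  where
  pascal : + (suc n C suc k) ≡ + (n C k) + + (n C suc k)
  pascal = trans (cong +_ (sym (nCk+nC[k+1]≡[n+1]C[k+1] n k))) (pos-+ (n C k) (n C suc k))

  distribute : ∀ a i p q x → i * ((p + q) * (a * x)) ≡ i * (q * (a * x)) + a * (i * (p * x))
  distribute = solve-∀

sumRes-pascal : ∀ a {r r'} → ResiduePredecessor r r' → ∀ n k →
  sumRes a r (suc n) (suc k) ≡ sumRes a r n (suc k) + a * sumRes a r' n k
sumRes-pascal a {r} {r'} pred n zero = begin
  sumRes a r (suc n) 1
    ≡⟨ sumRes-suc a r (suc n) 0 ⟩
  sumRes a r (suc n) 0 + binomialTerm a r (suc n) 1
    ≡⟨ cong₂ _+_ (sumRes-suc-zero a r n) (binomialTerm-pascal a pred n 0) ⟩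
  sumRes a r n 0 + (binomialTerm a r n 1 + a * binomialTerm a r' n 0)
    ≡⟨ +-assoc (sumRes a r n 0) _ _ ⟨
  sumRes a r n 0 + binomialTerm a r n 1 + a * binomialTerm a r' n 0
    ≡⟨ cong₂ (λ s t → s + a * t) (sumRes-suc a r n 0) (sumRes-zero a r' n) ⟨
  sumRes a r n 1 + a * sumRes a r' n 0
    ∎
sumRes-pascal a {r} {r'} pred n (suc k) = begin
  sumRes a r (suc n) (2 ℕ.+ k)
    ≡⟨ sumRes-suc a r (suc n) (suc k) ⟩
  sumRes a r (suc n) (suc k) + binomialTerm a r (suc n) (2 ℕ.+ k)
    ≡⟨ cong₂ _+_ (sumRes-pascal a pred n k) (binomialTerm-pascal a pred n (suc k)) ⟩
  (sumRes a r n (suc k) + a * sumRes a r' n k) + (binomialTerm a r n (2 ℕ.+ k) + a * binomialTerm a r' n (suc k))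
    ≡⟨ regroup a (sumRes a r n (suc k)) (sumRes a r' n k) (binomialTerm a r n (2 ℕ.+ k)) (binomialTerm a r' n (suc k)) ⟩
  (sumRes a r n (suc k) + binomialTerm a r n (2 ℕ.+ k)) + a * (sumRes a r' n k + binomialTerm a r' n (suc k))
    ≡⟨ cong₂ (λ s t → s + a * t) (sumRes-suc a r n (suc k)) (sumRes-suc a r' n k) ⟨
  sumRes a r n (2 ℕ.+ k) + a * sumRes a r' n (suc k)
    ∎
  where
  regroup : ∀ a s t x y → (s + a * t) + (x + a * y) ≡ (s + x) + a * (t + y)
  regroup = solve-∀

sumRes-beyond : ∀ a r n → sumRes a r n (suc n) ≡ sumRes a r n n
sumRes-beyond a r n = begin
  sumRes a r n (suc n)                         ≡⟨ sumRes-suc a r n n ⟩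
  sumRes a r n n + binomialTerm a r n (suc n)  ≡⟨ cong (λ t → sumRes a r n n + t) (binomialTerm-beyond a r n) ⟩
  sumRes a r n n + + 0                         ≡⟨ +-identityʳ (sumRes a r n n) ⟩
  sumRes a r n n                               ∎

Δ₃-suc : ∀ a {r r'} → ResiduePredecessor r r' → ∀ n → Δ₃ a r (suc n) ≡ Δ₃ a r n + a * Δ₃ a r' n
Δ₃-suc a {r} {r'} pred n = begin
  + 3 * sumRes a r (suc n) (suc n) - (+ 1 + a) ^ suc n
    ≡⟨ cong (λ s → + 3 * s - (+ 1 + a) ^ suc n) sumRes-diagonal ⟩
  + 3 * (sumRes a r n n + a * sumRes a r' n n) - (+ 1 + a) * (+ 1 + a) ^ n
    ≡⟨ split a (sumRes a r n n) (sumRes a r' n n) ((+ 1 + a) ^ n) ⟩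
  Δ₃ a r n + a * Δ₃ a r' n
    ∎
  where
  sumRes-diagonal : sumRes a r (suc n) (suc n) ≡ sumRes a r n n + a * sumRes a r' n n
  sumRes-diagonal = trans (sumRes-pascal a pred n n) (cong (λ s → s + a * sumRes a r' n n) (sumRes-beyond a r n))

  split : ∀ a s t p → + 3 * (s + a * t) - (+ 1 + a) * p ≡ (+ 3 * s - p) + a * (+ 3 * t - p)
  split = solve-∀

closedForm₀ closedForm₁ closedForm₂ : ℤ → ℕ → ℤ
closedForm₀ a n = + 2 * u a (suc n) - (+ 2 - a) * u a n
closedForm₁ a n = - u a (suc n) + (a + + 1) * u a n
closedForm₂ a n = - u a (suc n) - (+ 2 * a - + 1) * u a n

closedForm₀-suc : ∀ a n → closedForm₀ a (suc n) ≡ closedForm₀ a n + a * closedForm₂ a n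
closedForm₀-suc a n = identity a (u a (suc n)) (u a n)
  where
  identity : ∀ a x y → + 2 * ((+ 2 - a) * x - (a * a - a + + 1) * y) - (+ 2 - a) * x
                       ≡ (+ 2 * x - (+ 2 - a) * y) + a * (- x - (+ 2 * a - + 1) * y)
  identity = solve-∀

closedForm₁-suc : ∀ a n → closedForm₁ a (suc n) ≡ closedForm₁ a n + a * closedForm₀ a n
closedForm₁-suc a n = identity a (u a (suc n)) (u a n)
  where
  identity : ∀ a x y → - ((+ 2 - a) * x - (a * a - a + + 1) * y) + (a + + 1) * x
                       ≡ (- x + (a + + 1) * y) + a * (+ 2 * x - (+ 2 - a) * y)
  identity = solve-∀

closedForm₂-suc : ∀ a n → closedForm₂ a (suc n) ≡ closedForm₂ a n + a * closedForm₁ a n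
closedForm₂-suc a n = identity a (u a (suc n)) (u a n)
  where
  identity : ∀ a x y → - ((+ 2 - a) * x - (a * a - a + + 1) * y) - (+ 2 * a - + 1) * x
                       ≡ (- x - (+ 2 * a - + 1) * y) + a * (- x + (a + + 1) * y)
  identity = solve-∀

Δ₃≡closedForm : ∀ a n → (Δ₃ a 0 n ≡ closedForm₀ a n) × (Δ₃ a 1 n ≡ closedForm₁ a n) × (Δ₃ a 2 n ≡ closedForm₂ a n)
Δ₃≡closedForm a zero = base₀ a , base₁ a , base₂ a
  where
  base₀ : ∀ a → + 2 ≡ + 2 * + 1 - (+ 2 - a) * + 0
  base₀ = solve-∀
  base₁ : ∀ a → - + 1 ≡ - + 1 + (a + + 1) * + 0
  base₁ = solve-∀
  base₂ : ∀ a → - + 1 ≡ - + 1 - (+ 2 * a - + 1) * + 0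
  base₂ = solve-∀
Δ₃≡closedForm a (suc n) with Δ₃≡closedForm a n
... | e₀ , e₁ , e₂ =
  step pred₃-0 e₀ e₂ (closedForm₀-suc a n) ,
  step pred₃-1 e₁ e₀ (closedForm₁-suc a n) ,
  step pred₃-2 e₂ e₁ (closedForm₂-suc a n)
  where
  step : ∀ {r r' d d' d⁺} → ResiduePredecessor r r' → Δ₃ a r n ≡ d → Δ₃ a r' n ≡ d' →
         d⁺ ≡ d + a * d' → Δ₃ a r (suc n) ≡ d⁺
  step pred e e' d⁺-rec = trans (Δ₃-suc a pred n) (trans (cong₂ (λ x y → x + a * y) e e') (sym d⁺-rec))

closedForm₀-unfold : ∀ a m → closedForm₀ a (suc m) ≡ (+ 2 - a) * u a (suc m) - + 2 * (a * a - a + + 1) * u a m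
closedForm₀-unfold a m = identity a (u a (suc m)) (u a m)
  where
  identity : ∀ a x y → + 2 * ((+ 2 - a) * x - (a * a - a + + 1) * y) - (+ 2 - a) * x
                       ≡ (+ 2 - a) * x - + 2 * (a * a - a + + 1) * y
  identity = solve-∀

closedForm₁-unfold : ∀ a m → closedForm₁ a (suc m) ≡ (+ 2 * a - + 1) * u a (suc m) + (a * a - a + + 1) * u a m
closedForm₁-unfold a m = identity a (u a (suc m)) (u a m)
  where
  identity : ∀ a x y → - ((+ 2 - a) * x - (a * a - a + + 1) * y) + (a + + 1) * x
                       ≡ (+ 2 * a - + 1) * x + (a * a - a + + 1) * y
  identity = solve-∀

closedForm₂-unfold : ∀ a m → closedForm₂ a (suc m) ≡ (- a - + 1) * u a (suc m) + (a * a - a + + 1) * u a m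
closedForm₂-unfold a m = identity a (u a (suc m)) (u a m)
  where
  identity : ∀ a x y → - ((+ 2 - a) * x - (a * a - a + + 1) * y) - (+ 2 * a - + 1) * x
                       ≡ (- a - + 1) * x + (a * a - a + + 1) * y
  identity = solve-∀

-- The identities hold for every integer a.
theorem4p1 : (a : ℤ) → a ≢ + 0 → a ≢ + 1 → a ≢ - + 1 → (n : ℕ) → ℕ.NonZero n →
    let m = ℕ.pred n
        c = a * a - a + + 1
    in ((Δ₃ a 0 n ≡ (+ 2 - a) * u a n - + 2 * c * u a m)
        × (Δ₃ a 0 n ≡ + 2 * u a (suc n) - (+ 2 - a) * u a n))
     × ((Δ₃ a 1 n ≡ (+ 2 * a - + 1) * u a n + c * u a m)
        × (Δ₃ a 1 n ≡ - u a (suc n) + (a + + 1) * u a n))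
     × ((Δ₃ a 2 n ≡ (- a - + 1) * u a n + c * u a m)
        × (Δ₃ a 2 n ≡ - u a (suc n) - (+ 2 * a - + 1) * u a n))
theorem4p1 a _ _ _ (suc m) _ with Δ₃≡closedForm a (suc m)
... | e₀ , e₁ , e₂ =
  (trans e₀ (closedForm₀-unfold a m) , e₀) ,
  (trans e₁ (closedForm₁-unfold a m) , e₁) ,
  (trans e₂ (closedForm₂-unfold a m) , e₂)
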